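{- For all positive integers $k$, $l$, and $d$ with $k>l$, \[ \gamma(\mathbb{Z}_d,\{k,l\}) \;\ge\; \left\lfloor \frac{d}{k+l}\right\rfloor. \]
   Context: For a subset $A$ of $\mathbb{Z}_d$ and a positive integer $h$, $hA$ denotes the $h$-fold sumset $\{a_1+\cdots+a_h : a_i\in A\}$. For positive integers $k>l$, $A$ is $(k,l)$-sum-free if $kA\cap lA=\emptyset$. An arithmetic progression in $\mathbb{Z}_d$ is a set $\{a+i\cdot b : i=0,1,\dots,m-1\}$ with $m$ a positive integer, $a,b\in\mathbb{Z}_d$ and $m\le d/\gcd(d,b)$ (so it has exactly $m$ elements); when $m=1$ one takes $b=1$. $\gamma(\mathbb{Z}_d,\{k,l\})$ is the maximum size of a $(k,l)$-sum-free arithmetic progression in $\mathbb{Z}_d$ whose common difference $b$ satisfies $\gcd(b,d)=1$ (taken to be $0$ if there is none). -}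

module Defs where

open import Data.Nat using (ℕ; _+_; _*_; _<_; _≤_; NonZero; ≢-nonZero; ≢-nonZero⁻¹)
open import Data.Nat.Properties using (m+n≡0⇒m≡0)
open import Data.Nat.DivMod using (_%_)
open import Data.Vec using (Vec)
open import Data.Vec.Relation.Unary.All using (All)
open import Data.Product using (∃-syntax; _×_)
open import Data.Empty using (⊥)
open import Relation.Binary.PropositionalEquality using (_≡_)

-- Elements of ℤ_d are represented by residues x < d (natural numbers);
-- subsets of ℤ_d are predicates on ℕ (meant to hold only on residues).
sumℕ : ∀ {n} → Vec ℕ n → ℕ
sumℕ = Data.Vec.foldr _ _+_ 0
  where import Data.Vec

AP : (d : ℕ) .{{_ : NonZero d}} → (a b m : ℕ) → ℕ → Set
AP d a b m x = ∃[ i ] (i < m × x ≡ (a + i * b) % d)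

SumSet : (d : ℕ) .{{_ : NonZero d}} → (h : ℕ) → (ℕ → Set) → ℕ → Set
SumSet d h A x = ∃[ v ] (All A {h} v × x ≡ sumℕ v % d)

SumFree : (d : ℕ) .{{_ : NonZero d}} → (k l : ℕ) → (ℕ → Set) → Set
SumFree d k l A = ∀ x → SumSet d k A x → SumSet d l A x → ⊥

-- Instance so that the divisor k + l in ⌊d/(k+l)⌋ is recognised as nonzero.
instance
  +-nonZeroˡ : ∀ {m n} → .{{_ : NonZero m}} → NonZero (m + n)
  +-nonZeroˡ {m} {n} = ≢-nonZero (λ eq → ≢-nonZero⁻¹ m (m+n≡0⇒m≡0 m eq))

{-# OPTIONS --safe #-}
-- The consecutive progression A = {a, a+1, …, a+M} with M + 1 = ⌊d/(k+l)⌋ works.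
-- Integer sums of l elements of A lie in [l a, l (a+M)] and sums of k elements in
-- [k a, k (a+M)].  Choosing a = ⌊l M/(k−l)⌋ + 1 makes l (a+M) < k a, and the bound
-- (k+l)(M+1) ≤ d then gives k (a+M) < l a + d, so every sum in kA exceeds every sum
-- in lA by less than d; distinct integers less than d apart have distinct residues.
module Submission where

open import Defs
open import Data.Nat using (ℕ; suc; _+_; _*_; _∸_; _<_; _≤_; NonZero; >-nonZero; >-nonZero⁻¹; s≤s; z≤n)
open import Data.Nat.DivMod using (_/_; _%_; m%n<n; m<n⇒m%n≡m; m≡m%n+[m/n]*n; m/n*n≤m)
open import Data.Nat.GCD using (gcd; gcd-zeroˡ; gcd-zeroʳ)
open import Data.Nat.Properties
open import Data.Nat.Solver using (module +-*-Solver)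
open import Data.Product using (∃-syntax; _×_; _,_; proj₁; proj₂)
open import Data.Sum using (_⊎_; inj₁; inj₂)
open import Data.Vec using (Vec; []; _∷_)
open import Data.Vec.Relation.Unary.All using (All; []; _∷_)
open import Relation.Binary.PropositionalEquality
open import Relation.Nullary using (¬_)

open +-*-Solver

m<n<m+o⇒m%o≢n%o : ∀ {m n} o .{{_ : NonZero o}} → m < n → n < m + o → ¬ m % o ≡ n % o
m<n<m+o⇒m%o≢n%o {m} {n} o m<n n<m+o m%o≡n%o = <-irrefl refl (≤-trans n<m+o m+o≤n)
  where
  open ≤-Reasoning
  r : ℕ
  r = m % o
  m≡r+[m/o]*o : m ≡ r + m / o * o
  m≡r+[m/o]*o = m≡m%n+[m/n]*n m o
  n≡r+[n/o]*o : n ≡ r + n / o * o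
  n≡r+[n/o]*o = trans (m≡m%n+[m/n]*n n o) (cong (_+ n / o * o) (sym m%o≡n%o))
  m/o<n/o : m / o < n / o
  m/o<n/o = *-cancelʳ-< o _ _ (+-cancelˡ-< r _ _ (subst₂ _<_ m≡r+[m/o]*o n≡r+[n/o]*o m<n))
  m+o≤n : m + o ≤ n
  m+o≤n = begin
    m + o               ≡⟨ cong (_+ o) m≡r+[m/o]*o ⟩
    r + m / o * o + o   ≡⟨ +-assoc r _ o ⟩
    r + (m / o * o + o) ≡⟨ cong (r +_) (+-comm _ o) ⟩
    r + suc (m / o) * o ≤⟨ +-monoʳ-≤ r (*-monoˡ-≤ o m/o<n/o) ⟩
    r + n / o * o       ≡⟨ n≡r+[n/o]*o ⟨
    n                   ∎

_⊆[_,_] : (ℕ → Set) → ℕ → ℕ → Set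
A ⊆[ lo , hi ] = ∀ {y} → A y → lo ≤ y × y ≤ hi

AP-consecutive⊆[a,a+M] : ∀ d .{{_ : NonZero d}} a M → a + M < d → AP d a 1 (suc M) ⊆[ a , a + M ]
AP-consecutive⊆[a,a+M] d a M a+M<d (i , s≤s i≤M , refl)
  rewrite *-identityʳ i | m<n⇒m%n≡m (≤-<-trans (+-monoʳ-≤ a i≤M) a+M<d)
  = m≤m+n a i , +-monoʳ-≤ a i≤M

sumℕ-⊆[_,_] : ∀ {A lo hi h} → A ⊆[ lo , hi ] → (v : Vec ℕ h) → All A v →
              h * lo ≤ sumℕ v × sumℕ v ≤ h * hi
sumℕ-⊆[_,_] A⊆ []      []        = z≤n , z≤n
sumℕ-⊆[_,_] A⊆ (y ∷ v) (Ay ∷ Av) =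
  +-mono-≤ (proj₁ (A⊆ Ay)) (proj₁ (sumℕ-⊆[_,_] A⊆ v Av)) ,
  +-mono-≤ (proj₂ (A⊆ Ay)) (proj₂ (sumℕ-⊆[_,_] A⊆ v Av))

⊆[_,_]⇒SumFree : ∀ d .{{_ : NonZero d}} {k l A lo hi} → A ⊆[ lo , hi ] →
                 l * hi < k * lo → k * hi < l * lo + d → SumFree d k l A
⊆[_,_]⇒SumFree d {k} {l} {lo = lo} {hi} A⊆ lhi<klo khi<llo+d x (v , Av , x≡Σv) (w , Aw , x≡Σw) =
  m<n<m+o⇒m%o≢n%o d Σw<Σv Σv<Σw+d (trans (sym x≡Σw) x≡Σv)
  where
  open ≤-Reasoning
  Σv : k * lo ≤ sumℕ v × sumℕ v ≤ k * hi
  Σv = sumℕ-⊆[_,_] A⊆ v Av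
  Σw : l * lo ≤ sumℕ w × sumℕ w ≤ l * hi
  Σw = sumℕ-⊆[_,_] A⊆ w Aw
  Σw<Σv : sumℕ w < sumℕ v
  Σw<Σv = begin-strict
    sumℕ w ≤⟨ proj₂ Σw ⟩
    l * hi <⟨ lhi<klo ⟩
    k * lo ≤⟨ proj₁ Σv ⟩
    sumℕ v ∎
  Σv<Σw+d : sumℕ v < sumℕ w + d
  Σv<Σw+d = begin-strict
    sumℕ v     ≤⟨ proj₂ Σv ⟩
    k * hi     <⟨ khi<llo+d ⟩
    l * lo + d ≤⟨ +-monoˡ-≤ d (proj₁ Σw) ⟩
    sumℕ w + d ∎

module Window (l t M : ℕ) .{{_ : NonZero t}} .{{_ : NonZero l}} where

  start : ℕ
  start = suc (l * M / t)

  private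
    a k : ℕ
    a = start
    k = l + t

    lM<at : l * M < a * t
    lM<at = begin-strict
      l * M                      ≡⟨ m≡m%n+[m/n]*n (l * M) t ⟩
      l * M % t + l * M / t * t  <⟨ +-monoˡ-< _ (m%n<n (l * M) t) ⟩
      a * t                      ∎
      where open ≤-Reasoning

    at≤t+lM : a * t ≤ t + l * M
    at≤t+lM = +-monoʳ-≤ t (m/n*n≤m (l * M) t)

  lower-gap : l * (a + M) < k * a
  lower-gap = begin-strict
    l * (a + M)   ≡⟨ *-distribˡ-+ l a M ⟩
    l * a + l * M <⟨ +-monoʳ-< (l * a) lM<at ⟩
    l * a + a * t ≡⟨ solve 3 (λ l t a → l :* a :+ a :* t := (l :+ t) :* a) refl l t a ⟩
    k * a         ∎
    where open ≤-Reasoning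

  at+kM<[M+1][k+l] : a * t + k * M < suc M * (k + l)
  at+kM<[M+1][k+l] = begin-strict
    a * t + k * M             ≤⟨ +-monoˡ-≤ (k * M) at≤t+lM ⟩
    t + l * M + k * M         <⟨ +-monoˡ-< (k * M) (+-monoˡ-< (l * M) t<k+l) ⟩
    (k + l) + l * M + k * M   ≡⟨ solve 3 (λ l t M → (l :+ t :+ l) :+ l :* M :+ (l :+ t) :* M
                                                   := (con 1 :+ M) :* (l :+ t :+ l)) refl l t M ⟩
    suc M * (k + l)           ∎
    where
    open ≤-Reasoning
    t<k+l : t < k + l
    t<k+l = ≤-trans (m<n+m t (>-nonZero⁻¹ l)) (m≤m+n k l)

  upper-gap : k * (a + M) < l * a + suc M * (k + l)
  upper-gap = begin-strict
    k * (a + M)             ≡⟨ solve 4 (λ l t a M → (l :+ t) :* (a :+ M) := l :* a :+ (a :* t :+ (l :+ t) :* M))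
                                 refl l t a M ⟩
    l * a + (a * t + k * M) <⟨ +-monoʳ-< (l * a) at+kM<[M+1][k+l] ⟩
    l * a + suc M * (k + l) ∎
    where open ≤-Reasoning

  window<[M+1][k+l] : a + M < suc M * (k + l)
  window<[M+1][k+l] = ≤-<-trans (+-mono-≤ (m≤m*n a t) (m≤n*m M k)) at+kM<[M+1][k+l]

consecutive-AP-sumFree : ∀ {k l t} .{{_ : NonZero t}} d M .{{_ : NonZero d}} .{{_ : NonZero l}} →
  l + t ≡ k → suc M * (k + l) ≤ d →
  let a = Window.start l t M in a + M < d × SumFree d k l (AP d a 1 (suc M))
consecutive-AP-sumFree {l = l} {t} d M refl [M+1][k+l]≤d =
  a+M<d , ⊆[_,_]⇒SumFree d (AP-consecutive⊆[a,a+M] d start M a+M<d) lower-gap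
            (<-≤-trans upper-gap (+-monoʳ-≤ (l * start) [M+1][k+l]≤d))
  where
  open Window l t M
  a+M<d : start + M < d
  a+M<d = <-≤-trans window<[M+1][k+l] [M+1][k+l]≤d

corollary11 : (k l d : ℕ) → .{{_ : NonZero k}} → .{{_ : NonZero l}} → .{{_ : NonZero d}} →
    l < k →
    (d / (k + l) ≡ 0)
    ⊎ (∃[ a ] ∃[ b ] ∃[ m ]
    (a < d × b < d × 1 ≤ m × m * gcd d b ≤ d × gcd b d ≡ 1
    × SumFree d k l (AP d a b m)
    × d / (k + l) ≤ m))
corollary11 k l d l<k with d / (k + l) | m/n*n≤m d (k + l)
... | 0     | _               = inj₁ refl
... | suc M | [M+1][k+l]≤d    =
  inj₂ (a , 1 , suc M , a<d , ≤-<-trans (s≤s z≤n) a<d , s≤s z≤n , [M+1]*gcd[d,1]≤d ,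
        gcd-zeroˡ d , proj₂ window , ≤-refl)
  where
  k∸l-nonZero : NonZero (k ∸ l)
  k∸l-nonZero = >-nonZero (m<n⇒0<n∸m l<k)
  a : ℕ
  a = Window.start l (k ∸ l) M ⦃ k∸l-nonZero ⦄
  window : a + M < d × SumFree d k l (AP d a 1 (suc M))
  window = consecutive-AP-sumFree ⦃ k∸l-nonZero ⦄ d M (m+[n∸m]≡n (<⇒≤ l<k)) [M+1][k+l]≤d
  a<d : a < d
  a<d = ≤-<-trans (m≤m+n a M) (proj₁ window)
  [M+1]*gcd[d,1]≤d : suc M * gcd d 1 ≤ d
  [M+1]*gcd[d,1]≤d rewrite gcd-zeroʳ d | *-identityʳ (suc M) =
    ≤-trans (m≤m*n (suc M) (k + l)) [M+1][k+l]≤d
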